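{- Let $n,k$ be positive integers with $n\ge 2^k$ and let $s=\lfloor n/2^{k-1}\rfloor$ (so $s>1$). Let $S\subseteq\{1,\dots,n\}$ with $|S|\ge n-s+2$. Then there exist $k+1$ elements $s_0,\dots,s_k\in S$ such that $s_j>\sum_{i=0}^{j-1}s_i$ for every $1\le j\le k$. -}

module Defs where

open import Data.Nat using (ℕ; zero; suc; _+_)
open import Data.Fin using (Fin; zero; suc; toℕ)

prefixSum : ∀ {m} → (Fin m → ℕ) → ℕ → ℕ
prefixSum {zero}  f _       = 0
prefixSum {suc m} f zero    = 0
prefixSum {suc m} f (suc j) = f zero + prefixSum (λ i → f (suc i)) j

{-# OPTIONS --safe #-}
-- Pick the elements greedily: s_j is the least element of S above T_j = s_0 + ⋯ + s_(j-1).  If d_j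
-- numbers between T_j and s_j are missing from S, then s_j = T_j + 1 + d_j and T_(j+1) + 1 = 2 (T_j + 1) + d_j.
-- Let r_j bound the number of gaps of S in (T_j, n].  The budget 2^(k-j) (T_j + 1) + 2^(k-1) r_j never
-- increases: halving the power of 2 pays for doubling T_j + 1, and the d_j gaps left behind pay for
-- 2^(k-j-1) d_j ≤ 2^(k-1) d_j.  It starts at 2^(k-1) (m + 2) ≤ 2^(k-1) s ≤ n, where m ≤ s - 2 counts the gaps
-- of S in [1, n]; and while it is at most n, (T_j, n] has more numbers than gaps, so s_j exists.
module Submission where

open import Defs
open import Data.Nat using (ℕ; zero; suc; _+_; _∸_; _^_; _≤_; _<_; _/_; _*_; z≤n; s≤s; z<s; _≟_; NonZero)
open import Data.Nat.Properties
open import Data.Nat.DivMod using (m/n*n≤m)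
open import Data.Nat.Tactic.RingSolver using (solve-∀)
open import Data.Fin using (Fin; zero; suc; toℕ)
open import Data.Fin.Properties using (injective⇒≤)
open import Data.List using (List; []; _∷_; length; lookup)
open import Data.List.Membership.Propositional using (_∈_)
open import Data.List.Membership.Propositional.Properties using (∈-lookup)
open import Data.List.Membership.DecPropositional _≟_ using (_∈?_)
open import Data.List.Relation.Binary.Subset.Propositional using (_⊆_)
open import Data.List.Relation.Unary.All as All using (All)
open import Data.List.Relation.Unary.AllPairs using (_∷_)
open import Data.List.Relation.Unary.Any using (here; there; index)
open import Data.List.Relation.Unary.Any.Properties using (lookup-index)
open import Data.List.Relation.Unary.Unique.Propositional using (Unique)
import Data.Vec.Functional as Vec
open import Data.Product using (Σ; Σ-syntax; _×_; _,_)
open import Data.Sum using (inj₁; inj₂)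
open import Relation.Nullary using (yes; no; contradiction)
open import Relation.Unary using (Decidable)
open import Relation.Binary.PropositionalEquality

module _ {a} {A : Set a} where

  lookup-injective : ∀ {xs : List A} → Unique xs → ∀ i j → lookup xs i ≡ lookup xs j → i ≡ j
  lookup-injective (_    ∷ _) zero    zero    _  = refl
  lookup-injective (x∉xs ∷ _) zero    (suc j) eq = contradiction eq (All.lookup x∉xs (∈-lookup j))
  lookup-injective (x∉xs ∷ _) (suc i) zero    eq = contradiction (sym eq) (All.lookup x∉xs (∈-lookup i))
  lookup-injective (_    ∷ u) (suc i) (suc j) eq = cong suc (lookup-injective u i j eq)

  Unique-⊆⇒length≤ : ∀ {xs ys : List A} → Unique xs → xs ⊆ ys → length xs ≤ length ys
  Unique-⊆⇒length≤ {xs} {ys} xs! xs⊆ys = injective⇒≤ position-injective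
    where
    position : Fin (length xs) → Fin (length ys)
    position i = index (xs⊆ys (∈-lookup i))

    position-injective : ∀ {i j} → position i ≡ position j → i ≡ j
    position-injective {i} {j} eq = lookup-injective xs! i j (begin
      lookup xs i            ≡⟨ lookup-index (xs⊆ys (∈-lookup i)) ⟩
      lookup ys (position i) ≡⟨ cong (lookup ys) eq ⟩
      lookup ys (position j) ≡⟨ lookup-index (xs⊆ys (∈-lookup j)) ⟨
      lookup xs j            ∎)
      where open ≡-Reasoning

-- gaps a L and members a L split the window a + 1, …, a + L into the non-members and members of P.
module Gaps {p} {P : ℕ → Set p} (P? : Decidable P) where

  gaps : ℕ → ℕ → ℕ
  gaps a zero    = 0
  gaps a (suc L) with P? (suc a)
  ... | yes _ = gaps (suc a) L
  ... | no  _ = suc (gaps (suc a) L)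

  members : ℕ → ℕ → List ℕ
  members a zero    = []
  members a (suc L) with P? (suc a)
  ... | yes _ = suc a ∷ members (suc a) L
  ... | no  _ = members (suc a) L

  length-members+gaps : ∀ a L → length (members a L) + gaps a L ≡ L
  length-members+gaps a zero    = refl
  length-members+gaps a (suc L) with P? (suc a)
  ... | yes _ = cong suc (length-members+gaps (suc a) L)
  ... | no  _ = trans (+-suc _ _) (cong suc (length-members+gaps (suc a) L))

  ∈-members : ∀ a L {y} → P y → a < y → y ≤ a + L → y ∈ members a L
  ∈-members a zero    Py a<y y≤a+0 = contradiction (subst (_ ≤_) (+-identityʳ a) y≤a+0) (<⇒≱ a<y)
  ∈-members a (suc L) {y} Py a<y y≤a+1+L with P? (suc a) | m≤n⇒m<n∨m≡n a<y
  ... | yes _   | inj₂ refl  = here refl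
  ... | no  ¬Py | inj₂ refl  = contradiction Py ¬Py
  ... | yes _   | inj₁ 1+a<y = there (∈-members (suc a) L Py 1+a<y (subst (y ≤_) (+-suc a L) y≤a+1+L))
  ... | no  _   | inj₁ 1+a<y = ∈-members (suc a) L Py 1+a<y (subst (y ≤_) (+-suc a L) y≤a+1+L)

  Unique⇒length+gaps≤ : ∀ {xs} a L → Unique xs → (∀ {y} → y ∈ xs → P y × a < y × y ≤ a + L) →
                        length xs + gaps a L ≤ L
  Unique⇒length+gaps≤ a L xs! in-window = ≤-trans
    (+-monoˡ-≤ (gaps a L) (Unique-⊆⇒length≤ xs! λ y∈xs →
      let Py , a<y , y≤a+L = in-window y∈xs in ∈-members a L Py a<y y≤a+L))
    (≤-reflexive (length-members+gaps a L))

  gaps-suc : ∀ a L → gaps (suc a) L ≤ gaps a (suc L)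
  gaps-suc a L with P? (suc a)
  ... | yes _ = ≤-refl
  ... | no  _ = n≤1+n _

  gaps-drop : ∀ t a L → gaps (t + a) (L ∸ t) ≤ gaps a L
  gaps-drop zero    a L       = ≤-refl
  gaps-drop (suc t) a zero    = z≤n
  gaps-drop (suc t) a (suc L) rewrite sym (+-suc t a) = ≤-trans (gaps-drop t (suc a) L) (gaps-suc a L)

  next-member : ∀ a L r → gaps a L ≤ r → r < L →
                Σ[ d ∈ ℕ ] d ≤ r × P (a + suc d) × gaps (a + suc d) (L ∸ suc d) ≤ r ∸ d
  next-member a (suc L) r a-gaps (s≤s r≤L) with P? (suc a)
  ... | yes P1+a = 0 , z≤n , subst (λ x → P x × gaps x L ≤ r) (+-comm 1 a) (P1+a , a-gaps)
  next-member a (suc L) (suc r) (s≤s a-gaps) (s≤s r<L) | no _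
    with d , d≤r , Px , x-gaps ← next-member (suc a) L r a-gaps r<L
    = suc d , s≤s d≤r ,
      subst (λ x → P x × gaps x (L ∸ suc d) ≤ r ∸ d) (sym (+-suc a (suc d))) (Px , x-gaps)

  gapsBetween : ℕ → ℕ → ℕ
  gapsBetween a b = gaps a (b ∸ a)

  gapsBetween-dropˡ : ∀ t a b → gapsBetween (t + a) b ≤ gapsBetween a b
  gapsBetween-dropˡ t a b =
    subst (λ L → gaps (t + a) L ≤ gapsBetween a b) (trans (∸-+-assoc b a t) (cong (b ∸_) (+-comm a t)))
          (gaps-drop t a (b ∸ a))

  next-member-between : ∀ a b r → gapsBetween a b ≤ r → r < b ∸ a →
                        Σ[ d ∈ ℕ ] d ≤ r × P (a + suc d) × gapsBetween (a + suc d) b ≤ r ∸ d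
  next-member-between a b r a-gaps r<b-a
    with d , d≤r , Px , x-gaps ← next-member a (b ∸ a) r a-gaps r<b-a
    = d , d≤r , Px , subst (λ L → gaps (a + suc d) L ≤ r ∸ d) (∸-+-assoc b a (suc d)) x-gaps

SuperincreasingAbove : ℕ → ∀ {m} → (Fin m → ℕ) → Set
SuperincreasingAbove T f = ∀ j → T + prefixSum f (toℕ j) < f j

∷-superincreasing : ∀ {T x m} {f : Fin m → ℕ} → T < x → SuperincreasingAbove (T + x) f →
                    SuperincreasingAbove T (x Vec.∷ f)
∷-superincreasing {T}               T<x _     zero    = subst (_< _) (sym (+-identityʳ T)) T<x
∷-superincreasing {T} {x} {f = f} _   f-sup (suc j) = subst (_< f j) (+-assoc T x _) (f-sup j)

∷-all : ∀ {p} {P : ℕ → Set p} {x m} {f : Fin m → ℕ} → P x → (∀ i → P (f i)) → ∀ i → P ((x Vec.∷ f) i)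
∷-all Px _  zero    = Px
∷-all _  Pf (suc i) = Pf i

module Greedy {p} {P : ℕ → Set p} (P? : Decidable P) (n w : ℕ) .{{_ : NonZero w}} where
  open Gaps P?

  room : ∀ t {T r} → 2 ^ t * suc T + w * r ≤ n → r < n ∸ T
  room t {T} {r} budget = begin
    suc r         ≡⟨ m+n∸m≡n T (suc r) ⟨
    T + suc r ∸ T ≤⟨ ∸-monoˡ-≤ T T+1+r≤n ⟩
    n ∸ T         ∎
    where
    open ≤-Reasoning
    T+1+r≤n : T + suc r ≤ n
    T+1+r≤n = begin
      T + suc r             ≡⟨ +-suc T r ⟩
      suc T + r             ≤⟨ +-mono-≤ (m≤n*m (suc T) (2 ^ t) {{m^n≢0 2 t}}) (m≤n*m r w) ⟩
      2 ^ t * suc T + w * r ≤⟨ budget ⟩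
      n                     ∎

  budget-step : ∀ t {T d r} → 2 ^ suc t ≤ 2 * w → d ≤ r →
                2 ^ suc t * suc T + w * r ≤ n → 2 ^ t * suc (T + (T + suc d)) + w * (r ∸ d) ≤ n
  budget-step t {T} {d} {r} 2^[1+t]≤2w d≤r budget = begin
    2 ^ t * suc (T + (T + suc d)) + w * (r ∸ d)   ≡⟨ expand (2 ^ t) T d (w * (r ∸ d)) ⟩
    2 ^ suc t * suc T + (2 ^ t * d + w * (r ∸ d))
      ≤⟨ +-monoʳ-≤ (2 ^ suc t * suc T) (+-monoˡ-≤ (w * (r ∸ d)) (*-monoˡ-≤ d 2^t≤w)) ⟩
    2 ^ suc t * suc T + (w * d + w * (r ∸ d))     ≡⟨ cong (2 ^ suc t * suc T +_) (*-distribˡ-+ w d (r ∸ d)) ⟨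
    2 ^ suc t * suc T + w * (d + (r ∸ d))         ≡⟨ cong (λ r′ → 2 ^ suc t * suc T + w * r′) (m+[n∸m]≡n d≤r) ⟩
    2 ^ suc t * suc T + w * r                     ≤⟨ budget ⟩
    n                                             ∎
    where
    open ≤-Reasoning
    2^t≤w : 2 ^ t ≤ w
    2^t≤w = *-cancelˡ-≤ 2 2^[1+t]≤2w
    expand : ∀ P T d y → P * suc (T + (T + suc d)) + y ≡ 2 * P * suc T + (P * d + y)
    expand = solve-∀

  greedy : ∀ t T r → 2 ^ t ≤ 2 * w → gapsBetween T n ≤ r → 2 ^ t * suc T + w * r ≤ n →
           Σ[ f ∈ (Fin (suc t) → ℕ) ] (∀ i → P (f i)) × SuperincreasingAbove T f
  greedy t T r 2^t≤2w T-gaps budget with next-member-between T n r T-gaps (room t budget)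
  greedy zero    T r _        _ _      | d , _ , Px , _ =
    T + suc d Vec.∷ Vec.[] , ∷-all {P = P} Px (λ ()) , ∷-superincreasing (m<m+n T z<s) (λ ())
  greedy (suc t) T r 2^t≤2w _ budget | d , d≤r , Px , x-gaps
    with f , Pf , f-sup ← greedy t (T + (T + suc d)) (r ∸ d)
                            (≤-trans (*-cancelˡ-≤ 2 2^t≤2w) (m≤m+n w _))
                            (≤-trans (gapsBetween-dropˡ T (T + suc d) n) x-gaps)
                            (budget-step t 2^t≤2w d≤r budget)
    = T + suc d Vec.∷ f , ∷-all {P = P} Px Pf , ∷-superincreasing (m<m+n T z<s) f-sup

lemma3p8 : (n k : ℕ) → 1 ≤ k → 2 ^ k ≤ n →
    (S : List ℕ) → Unique S → All (λ x → 1 ≤ x × x ≤ n) S →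
    (n + 2) ∸ _/_ n (2 ^ (k ∸ 1)) {{m^n≢0 2 (k ∸ 1)}} ≤ length S →
    Σ (Fin (suc k) → ℕ) λ f →
      ((i : Fin (suc k)) → f i ∈ S) ×
      ((j : Fin (suc k)) → 1 ≤ toℕ j → prefixSum f (toℕ j) < f j)
lemma3p8 n zero    () _ _ _ _ _
lemma3p8 n (suc k) _  _ S S! S⊆[1,n] n+2-s≤|S|
  = let f , f∈S , f-sup = Greedy.greedy (_∈? S) n (2 ^ k) (suc k) 0 m ≤-refl ≤-refl budget
    in  f , f∈S , λ j _ → f-sup j
  where
  open Gaps (_∈? S)
  open ≤-Reasoning
  instance
    2^k≢0 : NonZero (2 ^ k)
    2^k≢0 = m^n≢0 2 k

  m s : ℕ
  m = gaps 0 n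
  s = n / 2 ^ k

  |S|+m≤n : length S + m ≤ n
  |S|+m≤n = Unique⇒length+gaps≤ 0 n S! λ y∈S → y∈S , All.lookup S⊆[1,n] y∈S

  m+2≤s : m + 2 ≤ s
  m+2≤s = +-cancelʳ-≤ (length S) (m + 2) s (begin
    m + 2 + length S ≡⟨ trans (+-comm (m + 2) (length S)) (sym (+-assoc (length S) m 2)) ⟩
    length S + m + 2 ≤⟨ +-monoˡ-≤ 2 |S|+m≤n ⟩
    n + 2            ≤⟨ m≤n+m∸n (n + 2) s ⟩
    s + (n + 2 ∸ s)  ≤⟨ +-monoʳ-≤ s n+2-s≤|S| ⟩
    s + length S     ∎)

  budget : 2 ^ suc k * 1 + 2 ^ k * m ≤ n
  budget = begin
    2 * 2 ^ k * 1 + 2 ^ k * m ≡⟨ factor (2 ^ k) m ⟩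
    2 ^ k * (m + 2)           ≤⟨ *-monoʳ-≤ (2 ^ k) m+2≤s ⟩
    2 ^ k * s                 ≡⟨ *-comm (2 ^ k) s ⟩
    s * 2 ^ k                 ≤⟨ m/n*n≤m n (2 ^ k) ⟩
    n                         ∎
    where
    factor : ∀ w m → 2 * w * 1 + w * m ≡ w * (m + 2)
    factor = solve-∀
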